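{- Let $k,\ell$ be positive integers with $k\le\ell$, let $G$ be a $k$-tree, and let $L$ be a simplicial ordering of $V(G)$. Then for every $v\in V(G)$, $\operatorname{WReach}_k[G,L,v]=\operatorname{GReach}_{k,\ell}[G,L,v]$.
   Context: A $k$-tree is a clique of order $k+1$ or a graph obtained from a smaller $k$-tree by adding a new vertex adjacent to $k$ pairwise adjacent vertices. A simplicial ordering $L$ of a $k$-tree is obtained by fixing a construction from an initial $(k+1)$-clique $K_0$, placing the vertices of $K_0$ first, and for other vertices ordering by time of addition. For $k,\ell\in\mathbb N\cup\{\infty\}$, a linear ordering $L$ and vertices $u\le_L v$, $u\in\operatorname{GReach}_{k,\ell}[G,L,v]$ iff there is a path $x_0\dots x_s$ with $x_0=v$, $x_s=u$, $s\le\ell$, $u<_L x_{i-1}$ for all $i\in\{1,\dots,s\}$, and $|\{j\in\{1,\dots,s\}: x_j<_L x_{i-1}\ \forall i\in\{1,\dots,j\}\}|\le k$ (so $v\in\operatorname{GReach}_{k,\ell}[G,L,v]$). $\operatorname{WReach}_k[G,L,v]:=\operatorname{GReach}_{k,k}[G,L,v]$, i.e. the set of $u$ reachable from $v$ by a path of length at most $k$ whose $L$-minimum vertex is $u$. -}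

module Defs where

open import Data.Nat as ℕ using (ℕ; zero; suc; _≤_; _<_)
open import Data.Fin as Fin using (Fin; toℕ; inject₁; fromℕ)
open import Data.Fin.Properties using (all?)
open import Data.List using (List; length; filter)
open import Data.Product using (Σ; ∃; _×_; _,_)
open import Relation.Binary.PropositionalEquality using (_≡_; _≢_)
open import Relation.Nullary using (Dec; ¬_)
open import Relation.Nullary.Decidable using (_→-dec_)
open import Function.Bundles using (_↔_; Inverse; _⇔_)
open import Function.Definitions using (Injective)
import Data.List as List
import Data.Fin as F

record Graph (n : ℕ) : Set₁ where
  field
    Adj     : Fin n → Fin n → Set
    sym     : ∀ {u v} → Adj u v → Adj v u
    irrefl  : ∀ {u} → ¬ Adj u u
open Graph public

-- Linear orderings of V(G) = Fin n, given as a bijection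
--   rank : vertex → position,  at : position → vertex.

LinearOrdering : ℕ → Set
LinearOrdering n = Fin n ↔ Fin n

infix 4 _<L[_]_ _≤L[_]_
_<L[_]_ : ∀ {n} → Fin n → LinearOrdering n → Fin n → Set
u <L[ L ] v = Inverse.to L u F.< Inverse.to L v

_≤L[_]_ : ∀ {n} → Fin n → LinearOrdering n → Fin n → Set
u ≤L[ L ] v = Inverse.to L u F.≤ Inverse.to L v

<L-dec : ∀ {n} (L : LinearOrdering n) (u v : Fin n) → Dec (u <L[ L ] v)
<L-dec L u v = Inverse.to L u F.<? Inverse.to L v

-- L is a simplicial ordering of the k-tree G: G is obtained by the
-- construction which starts from the (k+1)-clique formed by the
-- vertices at positions 0..k of L, and then adds the vertex at each
-- later position p, making it adjacent to exactly the vertices at the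
-- k pairwise distinct, pairwise adjacent earlier positions S(0..k-1)
-- (and to no other earlier vertex).

record SimplicialOrdering {n : ℕ} (k : ℕ) (G : Graph n) (L : LinearOrdering n) : Set where
  field
    enough   : suc k ≤ n
    initialClique : ∀ (p q : Fin n) → toℕ p ≤ k → toℕ q ≤ k → p ≢ q →
                    Adj G (Inverse.from L p) (Inverse.from L q)
    addition : ∀ (p : Fin n) → k < toℕ p →
               Σ (Fin k → Fin n) λ S →
                 Injective _≡_ _≡_ S
               × (∀ i → S i F.< p)
               × (∀ i j → i ≢ j → Adj G (Inverse.from L (S i)) (Inverse.from L (S j)))
               × (∀ q → q F.< p →
                    (Adj G (Inverse.from L p) (Inverse.from L q) ⇔ (∃ λ i → S i ≡ q)))

IsKTreeWithSimplicialOrdering : ∀ {n} → ℕ → Graph n → LinearOrdering n → Set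
IsKTreeWithSimplicialOrdering k G L = SimplicialOrdering k G L

record Path {n : ℕ} (G : Graph n) (s : ℕ) : Set where
  field
    vtx      : Fin (suc s) → Fin n
    distinct : Injective _≡_ _≡_ vtx
    adjacent : ∀ (i : Fin s) → Adj G (vtx (inject₁ i)) (vtx (Fin.suc i))
open Path public

-- Number of j ∈ {1,…,s} with x_j <_L x_{i-1} for all i ∈ {1,…,j}.
-- (Index j ∈ {1..s} is represented by j' : Fin s with j = j'+1, and
--  i ∈ {1..j} by i' : Fin s with i' ≤ j', x_{i-1} = vtx (inject₁ i').)
IsNewMin : ∀ {n} {G : Graph n} {s} → LinearOrdering n → Path G s → Fin s → Set
IsNewMin L P j = ∀ (i : Fin _) → i F.≤ j → vtx P (Fin.suc j) <L[ L ] vtx P (inject₁ i)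

isNewMin? : ∀ {n} {G : Graph n} {s} (L : LinearOrdering n) (P : Path G s) (j : Fin s) →
            Dec (IsNewMin L P j)
isNewMin? L P j = all? (λ i → (i F.≤? j) →-dec <L-dec L _ _)

countNewMin : ∀ {n} {G : Graph n} {s} → LinearOrdering n → Path G s → ℕ
countNewMin {s = s} L P = length (filter (isNewMin? L P) (List.allFin s))

GReach : ∀ {n} → ℕ → ℕ → Graph n → LinearOrdering n → Fin n → Fin n → Set
GReach k ℓ G L v u =
  u ≤L[ L ] v ×
  Σ ℕ λ s → Σ (Path G s) λ P →
      vtx P Fin.zero ≡ v
    × vtx P (fromℕ s) ≡ u
    × s ≤ ℓ
    × (∀ (i : Fin s) → u <L[ L ] vtx P (inject₁ i))
    × countNewMin L P ≤ k

-- u ∈ GReach_{k,ℓ}[G,L,v]  is  GReach k ℓ G L v u.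
WReach : ∀ {n} → ℕ → Graph n → LinearOrdering n → Fin n → Fin n → Set
WReach k = GReach k k

-- In a perfect elimination ordering, such as the simplicial ordering of a k-tree, the earlier
-- neighbours of any vertex are pairwise adjacent.  Reading a path x₀ … x_s from the end, this
-- maintains an L-decreasing walk along edges from x_j to u = x_s whose vertices are x_j followed
-- by the new minima of x_j … x_s: prepending x_{j-1} discards the vertices above x_{j-1}, and
-- x_{j-1} stays adjacent to the next vertex because each discarded vertex has both x_{j-1} and
-- its successor among its earlier neighbours.  At j = 0 this is a path from v to u with
-- countNewMin ≤ k edges, all of whose vertices except u lie above u.
module Submission where

open import Defs
open import Data.Nat using (ℕ; _≤_)
open import Data.Fin using (Fin)
open import Function.Bundles using (_⇔_)

open import Data.Nat as ℕ using (z≤n; s≤s)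
open import Data.Nat.Properties using (≤-trans; <⇒≤; ≮⇒≥; suc-injective)
open import Data.Fin as F using (zero; suc; toℕ; inject₁; fromℕ)
import Data.Fin.Properties as FP
open import Data.List using (List; []; _∷_; map; filter; length; allFin; tabulate)
open import Data.List.Properties
  using (filter-accept; filter-reject; filter-all; length-filter; length-map; length-tabulate; map-tabulate)
open import Data.List.Relation.Unary.All as All using (All; []; _∷_)
open import Data.Product using (Σ; _×_; _,_; proj₁; proj₂)
open import Data.Sum using (_⊎_; inj₁; inj₂)
open import Function using (_∘_; id)
open import Function.Bundles using (Inverse; Injection; Equivalence; mk⇔)
open import Function.Definitions using (Injective)
open import Function.Properties.Inverse using (↔⇒↣)
open import Relation.Binary.Definitions using (tri<; tri≈; tri>)
open import Relation.Binary.PropositionalEquality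
  using (_≡_; _≢_; refl; trans; cong; subst; subst₂; module ≡-Reasoning)
import Relation.Binary.PropositionalEquality as ≡
open import Relation.Unary as U using (Pred)
open import Level using (0ℓ)
open import Relation.Nullary using (Dec; yes; no; ¬_; contradiction)

module _ {A B C : Set} {P : Pred A 0ℓ} {Q : Pred C 0ℓ} {R : Pred B 0ℓ}
         (P? : U.Decidable P) (Q? : U.Decidable Q) (R? : U.Decidable R) (g : C → A) (f : A → B)
         (P⇔RQ : ∀ c → P (g c) ⇔ (R (f (g c)) × Q c)) where
  open Equivalence

  map-filter-map : ∀ cs → map f (filter P? (map g cs)) ≡ filter R? (map (f ∘ g) (filter Q? cs))
  map-filter-map []       = refl
  map-filter-map (c ∷ cs) with Q? c
  ... | no ¬q = trans
    (cong (map f) (filter-reject P? (¬q ∘ proj₂ ∘ to (P⇔RQ c))))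
    (map-filter-map cs)
  ... | yes q with R? (f (g c))
  ...   | yes r = trans
    (cong (map f) (filter-accept P? (from (P⇔RQ c) (r , q))))
    (cong (f (g c) ∷_) (map-filter-map cs))
  ...   | no ¬r = trans
    (cong (map f) (filter-reject P? (¬r ∘ proj₁ ∘ to (P⇔RQ c))))
    (map-filter-map cs)

module Order {n : ℕ} (L : LinearOrdering n) where

  infix 4 _≺_ _≺?_

  _≺_ : Fin n → Fin n → Set
  a ≺ b = a <L[ L ] b

  _≺?_ : ∀ a b → Dec (a ≺ b)
  _≺?_ = <L-dec L

  ≺-irrefl : ∀ {a} → ¬ a ≺ a
  ≺-irrefl = FP.<-irrefl refl

  ≺-trans : ∀ {a b c} → a ≺ b → b ≺ c → a ≺ c
  ≺-trans = FP.<-trans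

  ≢∧⊁⇒≺ : ∀ {a b} → a ≢ b → ¬ b ≺ a → a ≺ b
  ≢∧⊁⇒≺ {a} {b} a≢b b⊀a with FP.<-cmp (Inverse.to L a) (Inverse.to L b)
  ... | tri< a≺b _ _ = a≺b
  ... | tri≈ _ eq _  = contradiction (Injection.injective (↔⇒↣ L) eq) a≢b
  ... | tri> _ _ b≺a = contradiction b≺a b⊀a

PerfectElimination : ∀ {n} → Graph n → LinearOrdering n → Set
PerfectElimination G L = ∀ {a b c} → Adj G c a → Adj G c b → a ≺ c → b ≺ c → a ≡ b ⊎ Adj G a b
  where open Order L

module _ {n k : ℕ} {G : Graph n} {L : LinearOrdering n} (SO : SimplicialOrdering k G L) where
  open Inverse L using (to; from; strictlyInverseʳ)
  open SimplicialOrdering SO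

  earlierNeighbours-adjacent : ∀ {p q r} → p F.< r → q F.< r →
    Adj G (from r) (from p) → Adj G (from r) (from q) → p ≢ q → Adj G (from p) (from q)
  earlierNeighbours-adjacent {p} {q} {r} p<r q<r _ _ p≢q with k ℕ.<? toℕ r
  ... | no r≤k = initialClique p q (toℕ≤k p<r) (toℕ≤k q<r) p≢q
    where
      toℕ≤k : ∀ {x} → x F.< r → toℕ x ≤ k
      toℕ≤k x<r = ≤-trans (<⇒≤ x<r) (≮⇒≥ r≤k)
  earlierNeighbours-adjacent {p} {q} p<r q<r rp rq p≢q | yes k<r
    with addition _ k<r
  ... | S , _ , _ , clique , neighbours
    with Equivalence.to (neighbours p p<r) rp | Equivalence.to (neighbours q q<r) rq
  ... | i , refl | j , refl = clique i j (λ i≡j → p≢q (cong S i≡j))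

  simplicialOrdering⇒perfectElimination : PerfectElimination G L
  simplicialOrdering⇒perfectElimination {a} {b} {c} ca cb a≺c b≺c with a F.≟ b
  ... | yes a≡b = inj₁ a≡b
  ... | no a≢b  = inj₂ (subst₂ (Adj G) (strictlyInverseʳ a) (strictlyInverseʳ b)
                   (earlierNeighbours-adjacent a≺c b≺c (toPositions ca) (toPositions cb)
                      (a≢b ∘ Injection.injective (↔⇒↣ L))))
    where
      toPositions : ∀ {x y} → Adj G x y → Adj G (from (to x)) (from (to y))
      toPositions = subst₂ (Adj G) (≡.sym (strictlyInverseʳ _)) (≡.sym (strictlyInverseʳ _))

module Descents {n : ℕ} (G : Graph n) (L : LinearOrdering n) where
  open Order L

  data Descent : Fin n → Fin n → ℕ → Set where
    done : ∀ {u} → Descent u u 0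
    step : ∀ {a b u t} → Adj G a b → b ≺ a → Descent b u t → Descent a u (ℕ.suc t)

  vertices : ∀ {a u t} → Descent a u t → List (Fin n)
  later    : ∀ {a u t} → Descent a u t → List (Fin n)

  vertices {a} d = a ∷ later d

  later done         = []
  later (step _ _ d) = vertices d

  length-vertices : ∀ {a u t} (d : Descent a u t) → length (vertices d) ≡ ℕ.suc t
  length-vertices done         = refl
  length-vertices (step _ _ d) = cong ℕ.suc (length-vertices d)

  later-below : ∀ {a u t} (d : Descent a u t) → All (_≺ a) (later d)
  later-below done           = []
  later-below (step _ b≺a d) = b≺a ∷ All.map (λ x≺b → ≺-trans x≺b b≺a) (later-below d)

  vertexAt : ∀ {a u t} → Descent a u t → Fin (ℕ.suc t) → Fin n
  vertexAt {a} _         zero    = a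
  vertexAt (step _ _ d) (suc i) = vertexAt d i

  vertexAt-below : ∀ {a b u t} (d : Descent b u t) → b ≺ a → ∀ j → vertexAt d j ≺ a
  vertexAt-below d              b≺a zero    = b≺a
  vertexAt-below (step _ c≺b d) b≺a (suc j) = vertexAt-below d (≺-trans c≺b b≺a) j

  vertexAt-injective : ∀ {a u t} (d : Descent a u t) → Injective _≡_ _≡_ (vertexAt d)
  vertexAt-injective d              {zero}  {zero}  _  = refl
  vertexAt-injective (step _ b≺a d) {zero}  {suc j} eq =
    contradiction (subst (_≺ _) (≡.sym eq) (vertexAt-below d b≺a j)) ≺-irrefl
  vertexAt-injective (step _ b≺a d) {suc i} {zero}  eq =
    contradiction (subst (_≺ _) eq (vertexAt-below d b≺a i)) ≺-irrefl
  vertexAt-injective (step _ _ d)   {suc i} {suc j} eq = cong suc (vertexAt-injective d eq)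

  vertexAt-adjacent : ∀ {a u t} (d : Descent a u t) (i : Fin t) →
                      Adj G (vertexAt d (inject₁ i)) (vertexAt d (suc i))
  vertexAt-adjacent (step ab _ _) zero    = ab
  vertexAt-adjacent (step _ _ d)  (suc i) = vertexAt-adjacent d i

  vertexAt-last : ∀ {a u t} (d : Descent a u t) → vertexAt d (fromℕ t) ≡ u
  vertexAt-last done         = refl
  vertexAt-last (step _ _ d) = vertexAt-last d

  end-below-start : ∀ {a u t} → Descent a u (ℕ.suc t) → u ≺ a
  end-below-start (step _ b≺a done)           = b≺a
  end-below-start (step _ b≺a d@(step _ _ _)) = ≺-trans (end-below-start d) b≺a

  end-below-vertexAt : ∀ {a u t} (d : Descent a u t) (i : Fin t) → u ≺ vertexAt d (inject₁ i)
  end-below-vertexAt d@(step _ _ _) zero    = end-below-start d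
  end-below-vertexAt (step _ _ d)   (suc i) = end-below-vertexAt d i

  toPath : ∀ {a u t} → Descent a u t → Path G t
  toPath d = record
    { vtx      = vertexAt d
    ; distinct = vertexAt-injective d
    ; adjacent = vertexAt-adjacent d
    }

module NewMinima {n : ℕ} {G : Graph n} (L : LinearOrdering n) where
  open Order L

  countNewMin≤length : ∀ {s} (P : Path G s) → countNewMin L P ≤ s
  countNewMin≤length {s} P =
    subst (countNewMin L P ≤_) (length-tabulate id) (length-filter (isNewMin? L P) (allFin s))

  newMins : ∀ {s} → Path G s → List (Fin n)
  newMins {s} P = map (vtx P ∘ suc) (filter (isNewMin? L P) (allFin s))

  length-newMins : ∀ {s} (P : Path G s) → length (newMins P) ≡ countNewMin L P
  length-newMins {s} P = length-map _ (filter (isNewMin? L P) (allFin s))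

  tail : ∀ {s} → Path G (ℕ.suc s) → Path G s
  tail P = record
    { vtx      = vtx P ∘ suc
    ; distinct = λ eq → FP.suc-injective (distinct P eq)
    ; adjacent = adjacent P ∘ suc
    }

  module _ {s} (P : Path G (ℕ.suc s)) where

    isNewMin-zero⁺ : vtx P (suc zero) ≺ vtx P zero → IsNewMin L P zero
    isNewMin-zero⁺ x₁≺x₀ zero _ = x₁≺x₀

    isNewMin-zero⁻ : IsNewMin L P zero → vtx P (suc zero) ≺ vtx P zero
    isNewMin-zero⁻ m = m zero z≤n

    isNewMin-suc⁺ : ∀ {j} → vtx P (suc (suc j)) ≺ vtx P zero → IsNewMin L (tail P) j →
                   IsNewMin L P (suc j)
    isNewMin-suc⁺ below _ zero    _         = below
    isNewMin-suc⁺ _     m (suc i) (s≤s i≤j) = m i i≤j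

    isNewMin-suc⁻ : ∀ {j} → IsNewMin L P (suc j) →
                    vtx P (suc (suc j)) ≺ vtx P zero × IsNewMin L (tail P) j
    isNewMin-suc⁻ m = m zero z≤n , λ i i≤j → m (suc i) (s≤s i≤j)

    newMins-after-zero : map (vtx P ∘ suc) (filter (isNewMin? L P) (tabulate suc))
                           ≡ filter (_≺? vtx P zero) (newMins (tail P))
    newMins-after-zero =
      trans (cong (map (vtx P ∘ suc) ∘ filter (isNewMin? L P)) (≡.sym (map-tabulate id suc)))
            (map-filter-map (isNewMin? L P) (isNewMin? L (tail P)) (_≺? vtx P zero) suc (vtx P ∘ suc)
               (λ _ → mk⇔ isNewMin-suc⁻ λ (below , m) → isNewMin-suc⁺ below m) (allFin s))

    newMins-tail : newMins P ≡ filter (_≺? vtx P zero) (vtx P (suc zero) ∷ newMins (tail P))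
    newMins-tail with vtx P (suc zero) ≺? vtx P zero
    ... | yes x₁≺x₀ = trans
      (cong (map _) (filter-accept (isNewMin? L P) (isNewMin-zero⁺ x₁≺x₀)))
      (trans (cong (_ ∷_) newMins-after-zero) (≡.sym (filter-accept (_≺? vtx P zero) x₁≺x₀)))
    ... | no x₁⊀x₀ = trans
      (cong (map _) (filter-reject (isNewMin? L P) (x₁⊀x₀ ∘ isNewMin-zero⁻)))
      (trans newMins-after-zero (≡.sym (filter-reject (_≺? vtx P zero) x₁⊀x₀)))

module _ {n : ℕ} {G : Graph n} {L : LinearOrdering n} (peo : PerfectElimination G L) where
  open Order L
  open Descents G L
  open NewMinima {G = G} L

  prepend : ∀ {c u t} a → Adj G a c → u ≺ a → (d : Descent c u t) →
            Σ ℕ λ t′ → Σ (Descent a u t′) λ d′ → vertices d′ ≡ a ∷ filter (_≺? a) (vertices d)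
  prepend {c} a ac u≺a d with c ≺? a
  ... | yes c≺a =
    _ , step ac c≺a d , cong (a ∷_) (≡.sym (filter-all (_≺? a) (later-below (step ac c≺a d))))
  prepend a ac u≺a done | no u⊀a = contradiction u≺a u⊀a
  prepend a ac u≺a (step {c} cb b≺c d) | no c⊀a
    with peo (Graph.sym G ac) cb (≢∧⊁⇒≺ (λ { refl → Graph.irrefl G ac }) c⊀a) b≺c
  ... | inj₁ refl = _ , d , cong (a ∷_) (≡.sym (begin
      filter (_≺? a) (c ∷ a ∷ later d) ≡⟨ filter-reject (_≺? a) c⊀a ⟩
      filter (_≺? a) (a ∷ later d)     ≡⟨ filter-reject (_≺? a) ≺-irrefl ⟩
      filter (_≺? a) (later d)         ≡⟨ filter-all (_≺? a) (later-below d) ⟩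
      later d                          ∎))
    where open ≡-Reasoning
  ... | inj₂ ab with prepend a ab u≺a d
  ...   | t′ , d′ , eq = t′ , d′ , trans eq (cong (a ∷_) (≡.sym (filter-reject (_≺? a) c⊀a)))

  descentAlong : ∀ {s} (P : Path G s) → (∀ i → vtx P (fromℕ s) ≺ vtx P (inject₁ i)) →
                 Σ ℕ λ t → Σ (Descent (vtx P zero) (vtx P (fromℕ s)) t) λ d →
                   vertices d ≡ vtx P zero ∷ newMins P
  descentAlong {ℕ.zero}  P _     = 0 , done , refl
  descentAlong {ℕ.suc s} P u≺P with descentAlong (tail P) (λ i → u≺P (suc i))
  ... | _ , d , eq with prepend (vtx P zero) (adjacent P zero) (u≺P zero) d
  ...   | t′ , d′ , eq′ = t′ , d′ , (begin
      vertices d′                                                ≡⟨ eq′ ⟩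
      x₀ ∷ filter (_≺? x₀) (vertices d)                          ≡⟨ cong (λ vs → x₀ ∷ filter (_≺? x₀) vs) eq ⟩
      x₀ ∷ filter (_≺? x₀) (vtx P (suc zero) ∷ newMins (tail P)) ≡⟨ cong (x₀ ∷_) (newMins-tail P) ⟨
      x₀ ∷ newMins P                                             ∎)
    where
      open ≡-Reasoning
      x₀ = vtx P zero

  GReach⇒WReach : ∀ {m ℓ v u} → GReach m ℓ G L v u → WReach m G L v u
  GReach⇒WReach {m} (u≤v , s , P , refl , refl , _ , u≺P , newMin≤m) with descentAlong P u≺P
  ... | t , d , eq = u≤v , t , toPath d , refl , vertexAt-last d , t≤m , end-below-vertexAt d ,
                     ≤-trans (countNewMin≤length (toPath d)) t≤m
    where
      t≡countNewMin : t ≡ countNewMin L P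
      t≡countNewMin = suc-injective (begin
        ℕ.suc t                     ≡⟨ length-vertices d ⟨
        length (vertices d)         ≡⟨ cong length eq ⟩
        ℕ.suc (length (newMins P))  ≡⟨ cong ℕ.suc (length-newMins P) ⟩
        ℕ.suc (countNewMin L P)     ∎)
        where open ≡-Reasoning
      t≤m : t ≤ m
      t≤m = subst (_≤ m) (≡.sym t≡countNewMin) newMin≤m

GReach-mono-ℓ : ∀ {n m ℓ ℓ′} {G : Graph n} {L : LinearOrdering n} {v u} →
                ℓ ≤ ℓ′ → GReach m ℓ G L v u → GReach m ℓ′ G L v u
GReach-mono-ℓ ℓ≤ℓ′ (u≤v , s , P , start , end , s≤ℓ , u≺P , newMin≤m) =
  u≤v , s , P , start , end , ≤-trans s≤ℓ ℓ≤ℓ′ , u≺P , newMin≤m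

mainTheorem11 : (k ℓ : ℕ) → 1 ≤ k → k ≤ ℓ →
    {n : ℕ} (G : Graph n) (L : LinearOrdering n) →
    IsKTreeWithSimplicialOrdering k G L →
    (v u : Fin n) → (WReach k G L v u ⇔ GReach k ℓ G L v u)
mainTheorem11 k ℓ _ k≤ℓ G L SO v u = mk⇔
  (GReach-mono-ℓ {G = G} {L = L} k≤ℓ)
  (GReach⇒WReach {G = G} {L = L} (simplicialOrdering⇒perfectElimination SO))
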